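{- Let $n\ge k\ge 2$, $c\ge 2$, $1\le s\le c-1$, let $t=\lceil sk/c\rceil$ and let $\lambda\in[c]$ satisfy $\lambda\equiv sk\pmod c$. Let $\mathcal{F}\subseteq\binom{[n]}{k}$ be a $(c,s)$-frameproof hypergraph and let $\mathcal{F}_0=\{A\in\mathcal{F}: A \text{ has no own } (t-1)\text{ -subset with respect to }\mathcal{F}\}$. Then every $A\in\mathcal{F}_0$ contains at least $\binom{k}{t}-m(k,t,\lambda;s+1,c-s+1)$ own $t$-subsets with respect to $\mathcal{F}$.
   Context: $[m]=\{1,\dots,m\}$; $\binom{X}{k}$ is the family of $k$-subsets of $X$. A hypergraph $\mathcal{F}\subseteq 2^{[n]}$ is $(c,s)$-frameproof if for every $c+1$ edges $A_0,A_1,\dots,A_c\in\mathcal{F}$ with $A_0\neq A_j$ for each $j\in[c]$ ($A_1,\dots,A_c$ not necessarily distinct), there is some $i\in A_0$ with $|\{j\in[c]:i\in A_j\}|<s$. For $A\in\mathcal{F}$, a subset $T\subseteq A$ is an own subset of $A$ with respect to $\mathcal{F}$ if $T\not\subseteq B$ for every $B\in\mathcal{F}\setminus\{A\}$. A sequence $A_1,\dots,A_\lambda$ of subsets of $[k]$ (repetitions allowed) is $(k_1,k_2)$-disjoint if $\bigcap_{i\in B}A_i=\emptyset$ for every $k_1$-subset $B\subseteq[\lambda]$ and $\bigcup_{i\in B}A_i=[k]$ for every $k_2$-subset $B\subseteq[\lambda]$ (each condition vacuous if the subset size exceeds $\lambda$). $m(k,t,\lambda;k_1,k_2)$ is the maximum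 size of $\mathcal{F}\subseteq\binom{[k]}{t}$ containing no $A_1,\dots,A_\lambda\in\mathcal{F}$ (not necessarily distinct) forming a $(k_1,k_2)$-disjoint sequence. -}

module Defs where

open import Data.Nat using (ℕ; zero; suc; _+_; _*_; _∸_; _<_; _≤_; NonZero)
open import Data.Nat.DivMod using (_/_)
open import Data.Fin using (Fin)
open import Data.Fin.Subset using (Subset; _∈_; _∉_; _⊆_; ∣_∣)
open import Data.Fin.Subset.Properties using (_∈?_)
open import Data.Vec using (tabulate)
open import Data.List using (List; length)
open import Data.List.Membership.Propositional using () renaming (_∈_ to _∈ₗ_)
open import Data.List.Relation.Unary.All using (All)
open import Data.List.Relation.Unary.Unique.Propositional using (Unique)
open import Data.Product using (Σ; ∃; _×_)
open import Relation.Nullary using (¬_; does)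
open import Relation.Binary.PropositionalEquality using (_≡_; _≢_)

⌈_/_⌉ : ℕ → (c : ℕ) → .{{NonZero c}} → ℕ
⌈ a / c ⌉ = (a + (c ∸ 1)) / c

-- A hypergraph on [n] (vertex set Fin n): a duplicate-free finite list of edges.
-- F ⊆ binom([n],k): every edge has exactly k elements.
Uniform : ∀ {n} → ℕ → List (Subset n) → Set
Uniform k F = All (λ A → ∣ A ∣ ≡ k) F

countIn : ∀ {n c} → Fin n → (Fin c → Subset n) → ℕ
countIn i A = ∣ tabulate (λ j → does (i ∈? A j)) ∣

Frameproof : ∀ {n} → ℕ → ℕ → List (Subset n) → Set
Frameproof {n} c s F =
  (A₀ : Subset n) → A₀ ∈ₗ F →
  (A : Fin c → Subset n) → (∀ j → A j ∈ₗ F) → (∀ j → A₀ ≢ A j) →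
  Σ (Fin n) λ i → i ∈ A₀ × countIn i A < s

Own : ∀ {n} → List (Subset n) → Subset n → Subset n → Set
Own F A T = T ⊆ A × (∀ B → B ∈ₗ F → B ≢ A → ¬ (T ⊆ B))

Disjoint : ∀ {k λ′} → ℕ → ℕ → (Fin λ′ → Subset k) → Set
Disjoint {k} {λ′} k₁ k₂ A =
  (∀ (B : Subset λ′) → ∣ B ∣ ≡ k₁ →
     ¬ (Σ (Fin k) λ x → ∀ i → i ∈ B → x ∈ A i))
  × (∀ (B : Subset λ′) → ∣ B ∣ ≡ k₂ →
     ∀ (x : Fin k) → Σ (Fin λ′) λ i → i ∈ B × x ∈ A i)

Admissible : (k t λ′ k₁ k₂ : ℕ) → List (Subset k) → Set
Admissible k t λ′ k₁ k₂ G =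
  Unique G × Uniform t G ×
  ((A : Fin λ′ → Subset k) → (∀ i → A i ∈ₗ G) → ¬ Disjoint k₁ k₂ A)

IsM : (k t λ′ k₁ k₂ m : ℕ) → Set
IsM k t λ′ k₁ k₂ m =
  (Σ (List (Subset k)) λ G → Admissible k t λ′ k₁ k₂ G × length G ≡ m)
  × (∀ G → Admissible k t λ′ k₁ k₂ G → length G ≤ m)

module Submission where

-- Every t-subset of A that is not own lies in another edge of F. Suppose λ′ of these formed an
-- (s + 1, c − s + 1)-disjoint sequence, and write c = λ′ + r and s k = q c + λ′, so that t = q + 1.
-- Each vertex of A then lies in at most s of them and misses at most c − s of them, so its
-- deficit s − deg lies in [0, r], and the deficits add up to s k − λ′ t = r q. Such a demand can be
-- met by r sets of size q (peel off one set at a time, always taking the vertices of largest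
-- demand), and these are not own either, since A has no own (t − 1)-subset. The c edges
-- containing all these sets cover every vertex of A at least s times, which a (c, s)-frameproof
-- family forbids. Hence the non-own t-subsets of A form a family counted by
-- m(k, t, λ′; s + 1, c − s + 1), and all the other t-subsets of A are own.

open import Defs

-- Here _∈_ is membership in a Subset; the statement of lemma2p3 uses list membership.
module _ where

  open import Data.Nat using (ℕ; zero; suc; _+_; _*_; _∸_; _≤_; _<_; z≤n; s≤s; _≤?_; _<?_; NonZero)
  open import Data.Nat.Properties
  open import Data.Nat.DivMod
    using (_%_; _/_; m≡m%n+[m/n]*n; m<n⇒m%n≡m; n%n≡0; /-congˡ; +-distrib-/-∣ʳ; m<n⇒m/n≡0; m*n/n≡m)
  open import Data.Nat.Divisibility using (n∣m*n)
  open import Data.Nat.Combinatorics using (_C_; nCk+nC[k+1]≡[n+1]C[k+1])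
  open import Data.Nat.Tactic.RingSolver using (solve-∀)
  open import Data.Bool using (Bool; true; false)
  import Data.Bool as Bool
  open import Data.Fin using (Fin; zero; suc; splitAt)
  open import Data.Fin.Subset using (Subset; _∈_; _⊆_; ∣_∣)
  open import Data.Fin.Subset.Properties
    using ( _∈?_; _⊆?_; ∣p∣≤n; ⊆-refl; ⊆-min; ⊆-max; ∣⊥∣≡0; ∣⊤∣≡n; ∣∁p∣≡n∸∣p∣; x∈∁p⇒x∉p
          ; drop-∷-⊆; s⊆s; out⊆)
  open import Data.Vec using ([]; _∷_; tabulate; here; there)
  open import Data.Vec.Properties
    using (lookup∘tabulate; []=⇒lookup; lookup⇒[]=; ∷-injective; ∷-injectiveʳ; ≡-dec)
  open import Data.Vec.Functional using (Vector; _++_) renaming (_∷_ to _◂_)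
  import Data.Vec.Functional.Relation.Unary.All.Properties as Allᶠ
  open import Data.List using (List; []; _∷_; [_]; length; filter)
  import Data.List as List
  open import Data.List.Properties using (length-++; length-map)
  open import Data.List.Membership.Propositional using (find; lose) renaming (_∈_ to _∈ₗ_)
  open import Data.List.Membership.Propositional.Properties using (∈-map⁻; ∈-filter⁻)
  open import Data.List.Relation.Unary.Any using (any?)
  open import Data.List.Relation.Unary.All as All using (All)
  import Data.List.Relation.Unary.All.Properties as All
  import Data.List.Relation.Unary.AllPairs as AllPairs
  open import Data.List.Relation.Unary.Unique.Propositional using (Unique)
  import Data.List.Relation.Unary.Unique.Propositional.Properties as Unique
  open import Data.Sum using (inj₁; inj₂)
  open import Data.Product using (Σ-syntax; _×_; _,_; proj₁; proj₂)
  open import Function using (_∘_)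
  open import Relation.Nullary using (¬_; Dec; yes; no; does; ¬?; _×-dec_; contradiction)
  open import Relation.Nullary.Decidable using (dec-true; map′; decidable-stable)
  open import Relation.Binary.PropositionalEquality
    using (_≡_; refl; sym; trans; cong; cong₂; subst; _≢_; ≢-sym; _≗_; module ≡-Reasoning)
  import Algebra.Properties.Semiring.Sum as Sum
  open Sum +-*-semiring using (sum; sum-syntax; sum-cong-≗; ∑-comm; ∑-distrib-+; *-distribˡ-sum)

  -- Finite sums and degrees

  𝟙 : Bool → ℕ
  𝟙 true = 1
  𝟙 false = 0

  ∑-mono-≤ : ∀ {m} {f g : Vector ℕ m} → (∀ i → f i ≤ g i) → sum f ≤ sum g
  ∑-mono-≤ {zero} f≤g = z≤n
  ∑-mono-≤ {suc m} f≤g = +-mono-≤ (f≤g zero) (∑-mono-≤ (f≤g ∘ suc))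

  ∑-const : ∀ m x → ∑[ i < m ] x ≡ m * x
  ∑-const zero x = refl
  ∑-const (suc m) x = cong (x +_) (∑-const m x)

  ∑-++ : ∀ {A : Set} {a b} (w : A → ℕ) (X : Vector A a) (Y : Vector A b) →
    sum (w ∘ (X ++ Y)) ≡ sum (w ∘ X) + sum (w ∘ Y)
  ∑-++ {a = zero} w X Y = refl
  ∑-++ {a = suc a} w X Y = begin
    w (X zero) + sum (w ∘ (X ++ Y) ∘ suc)
      ≡⟨ cong (w (X zero) +_) (sum-cong-≗ (cong w ∘ ++-tail)) ⟩
    w (X zero) + sum (w ∘ ((X ∘ suc) ++ Y))
      ≡⟨ cong (w (X zero) +_) (∑-++ w (X ∘ suc) Y) ⟩
    w (X zero) + (sum (w ∘ X ∘ suc) + sum (w ∘ Y))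
      ≡⟨ +-assoc (w (X zero)) _ _ ⟨
    sum (w ∘ X) + sum (w ∘ Y) ∎
    where
    open ≡-Reasoning
    ++-tail : (X ++ Y) ∘ suc ≗ (X ∘ suc) ++ Y
    ++-tail i with splitAt a i
    ... | inj₁ _ = refl
    ... | inj₂ _ = refl

  ∣b∷p∣≡𝟙b+∣p∣ : ∀ {n} b (p : Subset n) → ∣ b ∷ p ∣ ≡ 𝟙 b + ∣ p ∣
  ∣b∷p∣≡𝟙b+∣p∣ true p = refl
  ∣b∷p∣≡𝟙b+∣p∣ false p = refl

  ∣p∣≡∑𝟙∈ : ∀ {n} (p : Subset n) → ∣ p ∣ ≡ ∑[ i < n ] 𝟙 (does (i ∈? p))
  ∣p∣≡∑𝟙∈ [] = refl
  ∣p∣≡∑𝟙∈ (b ∷ p) = trans (∣b∷p∣≡𝟙b+∣p∣ b p) (cong₂ _+_ (𝟙-head b) (∣p∣≡∑𝟙∈ p))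
    where
    𝟙-head : ∀ b → 𝟙 b ≡ 𝟙 (does (zero ∈? (b ∷ p)))
    𝟙-head true = refl
    𝟙-head false = refl

  ∑-*𝟙∈ : ∀ {n} m (p : Subset n) → ∑[ i < n ] (m * 𝟙 (does (i ∈? p))) ≡ m * ∣ p ∣
  ∑-*𝟙∈ m p = trans (sym (*-distribˡ-sum m (λ i → 𝟙 (does (i ∈? p))))) (cong (m *_) (sym (∣p∣≡∑𝟙∈ p)))

  ∣tabulate∣≡∑𝟙 : ∀ {n} (f : Vector Bool n) → ∣ tabulate f ∣ ≡ ∑[ i < n ] 𝟙 (f i)
  ∣tabulate∣≡∑𝟙 {zero} f = refl
  ∣tabulate∣≡∑𝟙 {suc n} f =
    trans (∣b∷p∣≡𝟙b+∣p∣ (f zero) (tabulate (f ∘ suc))) (cong (𝟙 (f zero) +_) (∣tabulate∣≡∑𝟙 (f ∘ suc)))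

  𝟙-does-mono : ∀ {P Q : Set} (P? : Dec P) (Q? : Dec Q) → (P → Q) → 𝟙 (does P?) ≤ 𝟙 (does Q?)
  𝟙-does-mono (no _) Q? P⇒Q = z≤n
  𝟙-does-mono (yes p) Q? P⇒Q rewrite dec-true Q? (P⇒Q p) = ≤-refl

  countIn≡∑ : ∀ {n c} (i : Fin n) (X : Fin c → Subset n) →
    countIn i X ≡ ∑[ ℓ < c ] 𝟙 (does (i ∈? X ℓ))
  countIn≡∑ i X = ∣tabulate∣≡∑𝟙 (λ ℓ → does (i ∈? X ℓ))

  countIn-mono : ∀ {m n c} {X : Fin c → Subset m} {Y : Fin c → Subset n} (j : Fin m) (i : Fin n) →
    (∀ ℓ → j ∈ X ℓ → i ∈ Y ℓ) → countIn j X ≤ countIn i Y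
  countIn-mono {c = c} {X} {Y} j i h = begin
    countIn j X                     ≡⟨ countIn≡∑ j X ⟩
    ∑[ ℓ < c ] 𝟙 (does (j ∈? X ℓ))  ≤⟨ ∑-mono-≤ (λ ℓ → 𝟙-does-mono (j ∈? X ℓ) (i ∈? Y ℓ) (h ℓ)) ⟩
    ∑[ ℓ < c ] 𝟙 (does (i ∈? Y ℓ))  ≡⟨ countIn≡∑ i Y ⟨
    countIn i Y                     ∎
    where open ≤-Reasoning

  countIn-++ : ∀ {n a b} (i : Fin n) (X : Fin a → Subset n) (Y : Fin b → Subset n) →
    countIn i (X ++ Y) ≡ countIn i X + countIn i Y
  countIn-++ {n} i X Y = begin
    countIn i (X ++ Y)           ≡⟨ countIn≡∑ i (X ++ Y) ⟩
    sum (𝟙∈ ∘ (X ++ Y))          ≡⟨ ∑-++ 𝟙∈ X Y ⟩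
    sum (𝟙∈ ∘ X) + sum (𝟙∈ ∘ Y)  ≡⟨ cong₂ _+_ (countIn≡∑ i X) (countIn≡∑ i Y) ⟨
    countIn i X + countIn i Y    ∎
    where
    open ≡-Reasoning
    𝟙∈ : Subset n → ℕ
    𝟙∈ B = 𝟙 (does (i ∈? B))

  ∑countIn≡∑∣∣ : ∀ {n c} (X : Fin c → Subset n) → ∑[ i < n ] countIn i X ≡ ∑[ ℓ < c ] ∣ X ℓ ∣
  ∑countIn≡∑∣∣ {n} {c} X = begin
    ∑[ i < n ] countIn i X                     ≡⟨ sum-cong-≗ (λ i → countIn≡∑ i X) ⟩
    ∑[ i < n ] ∑[ ℓ < c ] 𝟙 (does (i ∈? X ℓ))  ≡⟨ ∑-comm (λ i ℓ → 𝟙 (does (i ∈? X ℓ))) ⟩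
    ∑[ ℓ < c ] ∑[ i < n ] 𝟙 (does (i ∈? X ℓ))  ≡⟨ sum-cong-≗ (λ ℓ → ∣p∣≡∑𝟙∈ (X ℓ)) ⟨
    ∑[ ℓ < c ] ∣ X ℓ ∣                         ∎
    where open ≡-Reasoning

  -- Subsets

  ⊆-⊆-ofSize : ∀ {n} {X Z : Subset n} q → X ⊆ Z → ∣ X ∣ ≤ q → q ≤ ∣ Z ∣ →
    Σ[ Y ∈ Subset n ] X ⊆ Y × Y ⊆ Z × ∣ Y ∣ ≡ q
  ⊆-⊆-ofSize {X = []} {[]} q _ _ q≤0 = [] , ⊆-refl , ⊆-refl , sym (n≤0⇒n≡0 q≤0)
  ⊆-⊆-ofSize {X = true ∷ X} {false ∷ Z} q X⊆Z _ _ = contradiction (X⊆Z here) λ ()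
  ⊆-⊆-ofSize {X = true ∷ X} {true ∷ Z} (suc q) X⊆Z (s≤s X≤q) (s≤s q≤Z)
    with Y , X⊆Y , Y⊆Z , ∣Y∣≡q ← ⊆-⊆-ofSize q (drop-∷-⊆ X⊆Z) X≤q q≤Z =
    true ∷ Y , s⊆s X⊆Y , s⊆s Y⊆Z , cong suc ∣Y∣≡q
  ⊆-⊆-ofSize {X = false ∷ X} {false ∷ Z} q X⊆Z X≤q q≤Z
    with Y , X⊆Y , Y⊆Z , ∣Y∣≡q ← ⊆-⊆-ofSize q (drop-∷-⊆ X⊆Z) X≤q q≤Z =
    false ∷ Y , s⊆s X⊆Y , s⊆s Y⊆Z , ∣Y∣≡q
  ⊆-⊆-ofSize {X = false ∷ X} {true ∷ Z} q X⊆Z X≤q q≤1+Z with q ≤? ∣ Z ∣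
  ... | yes q≤Z with Y , X⊆Y , Y⊆Z , ∣Y∣≡q ← ⊆-⊆-ofSize q (drop-∷-⊆ X⊆Z) X≤q q≤Z =
    false ∷ Y , s⊆s X⊆Y , out⊆ Y⊆Z , ∣Y∣≡q
  ... | no q≰Z = true ∷ Z , out⊆ (drop-∷-⊆ X⊆Z) , ⊆-refl , ≤-antisym (≰⇒> q≰Z) q≤1+Z

  ⊆-ofSize : ∀ {n} {W : Subset n} q → q ≤ ∣ W ∣ → Σ[ B ∈ Subset n ] B ⊆ W × ∣ B ∣ ≡ q
  ⊆-ofSize {n} q q≤∣W∣
    with B , _ , B⊆W , ∣B∣≡q ← ⊆-⊆-ofSize q (⊆-min _) (≤-trans (≤-reflexive (∣⊥∣≡0 n)) z≤n) q≤∣W∣ =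
    B , B⊆W , ∣B∣≡q

  ⊇-ofSize : ∀ {n} (S : Subset n) {q} → ∣ S ∣ ≤ q → q ≤ n → Σ[ Y ∈ Subset n ] S ⊆ Y × ∣ Y ∣ ≡ q
  ⊇-ofSize {n} S {q} ∣S∣≤q q≤n
    with Y , S⊆Y , _ , ∣Y∣≡q ← ⊆-⊆-ofSize q (⊆-max S) ∣S∣≤q (≤-trans q≤n (≤-reflexive (sym (∣⊤∣≡n n)))) =
    Y , S⊆Y , ∣Y∣≡q

  subsetOf : ∀ {n} {P : Fin n → Set} → (∀ i → Dec (P i)) → Subset n
  subsetOf P? = tabulate (does ∘ P?)

  module _ {n} {P : Fin n → Set} (P? : ∀ i → Dec (P i)) where

    ∈-subsetOf⁺ : ∀ {i} → P i → i ∈ subsetOf P?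
    ∈-subsetOf⁺ {i} Pi = lookup⇒[]= i _ (trans (lookup∘tabulate (does ∘ P?) i) (dec-true (P? i) Pi))

    ∈-subsetOf⁻ : ∀ {i} → i ∈ subsetOf P? → P i
    ∈-subsetOf⁻ {i} i∈ with P? i | trans (sym (lookup∘tabulate (does ∘ P?) i)) ([]=⇒lookup i∈)
    ... | yes Pi | _ = Pi
    ... | no _ | ()

  -- embed A U is the subset of A selected by U when the elements of A are listed in increasing order.
  embed : ∀ {n} (A : Subset n) → Subset ∣ A ∣ → Subset n
  embed [] [] = []
  embed (false ∷ A) U = false ∷ embed A U
  embed (true ∷ A) (b ∷ U) = b ∷ embed A U

  embed-⊆ : ∀ {n} (A : Subset n) (U : Subset ∣ A ∣) → embed A U ⊆ A
  embed-⊆ (false ∷ A) U (there i∈) = there (embed-⊆ A U i∈)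
  embed-⊆ (true ∷ A) (b ∷ U) here = here
  embed-⊆ (true ∷ A) (b ∷ U) (there i∈) = there (embed-⊆ A U i∈)

  ∣embed∣ : ∀ {n} (A : Subset n) (U : Subset ∣ A ∣) → ∣ embed A U ∣ ≡ ∣ U ∣
  ∣embed∣ [] [] = refl
  ∣embed∣ (false ∷ A) U = ∣embed∣ A U
  ∣embed∣ (true ∷ A) (true ∷ U) = cong suc (∣embed∣ A U)
  ∣embed∣ (true ∷ A) (false ∷ U) = ∣embed∣ A U

  embed-injective : ∀ {n} (A : Subset n) {U V : Subset ∣ A ∣} → embed A U ≡ embed A V → U ≡ V
  embed-injective [] {[]} {[]} _ = refl
  embed-injective (false ∷ A) eq = embed-injective A (∷-injectiveʳ eq)
  embed-injective (true ∷ A) {b ∷ U} {c ∷ V} eq with refl , eq′ ← ∷-injective eq =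
    cong (b ∷_) (embed-injective A eq′)

  ∈-embed : ∀ {n} {A : Subset n} {i} → i ∈ A → Σ[ j ∈ Fin ∣ A ∣ ] ∀ {U} → j ∈ U → i ∈ embed A U
  ∈-embed {A = true ∷ A} here = zero , λ { {b ∷ U} here → here }
  ∈-embed {A = false ∷ A} (there i∈A) with j , j∈⇒i∈ ← ∈-embed i∈A = j , there ∘ j∈⇒i∈
  ∈-embed {A = true ∷ A} (there i∈A) with j , j∈⇒i∈ ← ∈-embed i∈A =
    suc j , λ { {b ∷ U} (there j∈U) → there (j∈⇒i∈ j∈U) }

  combinations : (k t : ℕ) → List (Subset k)
  combinations zero zero = [ [] ]
  combinations zero (suc t) = []
  combinations (suc k) zero = List.map (false ∷_) (combinations k zero)
  combinations (suc k) (suc t) =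
    List.map (true ∷_) (combinations k t) List.++ List.map (false ∷_) (combinations k (suc t))

  length-combinations : (k t : ℕ) → length (combinations k t) ≡ k C t
  length-combinations zero zero = refl
  length-combinations zero (suc t) = refl
  length-combinations (suc k) zero =
    trans (length-map (false ∷_) (combinations k zero)) (length-combinations k zero)
  length-combinations (suc k) (suc t) = begin
    length (List.map (true ∷_) (combinations k t) List.++ List.map (false ∷_) (combinations k (suc t)))
      ≡⟨ length-++ (List.map (true ∷_) (combinations k t)) ⟩
    length (List.map (true ∷_) (combinations k t)) + length (List.map (false ∷_) (combinations k (suc t)))
      ≡⟨ cong₂ _+_ (length-map (true ∷_) (combinations k t))
                   (length-map (false ∷_) (combinations k (suc t))) ⟩
    length (combinations k t) + length (combinations k (suc t))
      ≡⟨ cong₂ _+_ (length-combinations k t) (length-combinations k (suc t)) ⟩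
    k C t + k C suc t
      ≡⟨ nCk+nC[k+1]≡[n+1]C[k+1] k t ⟩
    suc k C suc t ∎
    where open ≡-Reasoning

  combinations-size : (k t : ℕ) → All (λ U → ∣ U ∣ ≡ t) (combinations k t)
  combinations-size zero zero = refl All.∷ All.[]
  combinations-size zero (suc t) = All.[]
  combinations-size (suc k) zero = All.map⁺ {f = false ∷_} (combinations-size k zero)
  combinations-size (suc k) (suc t) =
    All.++⁺ (All.map⁺ {f = true ∷_} (All.map (cong suc) (combinations-size k t)))
            (All.map⁺ {f = false ∷_} (combinations-size k (suc t)))

  combinations-unique : (k t : ℕ) → Unique (combinations k t)
  combinations-unique zero zero = All.[] AllPairs.∷ AllPairs.[]
  combinations-unique zero (suc t) = AllPairs.[]
  combinations-unique (suc k) zero = Unique.map⁺ ∷-injectiveʳ (combinations-unique k zero)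
  combinations-unique (suc k) (suc t) =
    Unique.++⁺ (Unique.map⁺ ∷-injectiveʳ (combinations-unique k t))
               (Unique.map⁺ ∷-injectiveʳ (combinations-unique k (suc t))) heads-differ
    where
    heads-differ : ∀ {v} →
      ¬ (v ∈ₗ List.map (true ∷_) (combinations k t) × v ∈ₗ List.map (false ∷_) (combinations k (suc t)))
    heads-differ (v∈₁ , v∈₂) with _ , _ , refl ← ∈-map⁻ (true ∷_) v∈₁ | _ , _ , () ← ∈-map⁻ (false ∷_) v∈₂

  -- Meeting a demand e : Fin k → ℕ with r sets of size at most p

  record Layer {k} (r p : ℕ) (e : Fin k → ℕ) : Set where
    field
      layer         : Subset k
      ∣layer∣≤p     : ∣ layer ∣ ≤ p
      max⊆layer     : ∀ j → suc r ≤ e j → j ∈ layer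
      layer⊆support : ∀ j → j ∈ layer → 1 ≤ e j
      ∑≤∣layer∣+r*p : ∑[ j < k ] e j ≤ ∣ layer ∣ + r * p

  -- The support Z of e if ∣ Z ∣ ≤ p; otherwise a p-subset of Z containing the set X of all j with
  -- e j = 1 + r, which fits because (1 + r) ∣ X ∣ ≤ ∑ e ≤ (1 + r) p.
  layer-exists : ∀ {k} r p (e : Fin k → ℕ) → (∀ j → e j ≤ suc r) → ∑[ j < k ] e j ≤ suc r * p →
    Layer r p e
  layer-exists {k} r p e e≤1+r ∑e≤ = choose (∣ Z ∣ ≤? p)
    where
    open ≤-Reasoning
    Z? : ∀ j → Dec (1 ≤ e j)
    Z? j = 1 ≤? e j
    X? : ∀ j → Dec (suc r ≤ e j)
    X? j = suc r ≤? e j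
    Z X : Subset k
    Z = subsetOf Z?
    X = subsetOf X?
    X⊆Z : X ⊆ Z
    X⊆Z j∈X = ∈-subsetOf⁺ Z? (≤-trans (s≤s z≤n) (∈-subsetOf⁻ X? j∈X))
    e≤1+r*𝟙Z : ∀ j → e j ≤ suc r * 𝟙 (does (j ∈? Z))
    e≤1+r*𝟙Z j with j ∈? Z
    ... | yes _ = ≤-trans (e≤1+r j) (≤-reflexive (sym (*-identityʳ (suc r))))
    ... | no j∉Z = ≤-trans (≮⇒≥ (j∉Z ∘ ∈-subsetOf⁺ Z?)) z≤n
    1+r*𝟙X≤e : ∀ j → suc r * 𝟙 (does (j ∈? X)) ≤ e j
    1+r*𝟙X≤e j with j ∈? X
    ... | yes j∈X = ≤-trans (≤-reflexive (*-identityʳ (suc r))) (∈-subsetOf⁻ X? j∈X)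
    ... | no _ = ≤-trans (≤-reflexive (*-zeroʳ r)) z≤n
    ∣X∣≤p : ∣ X ∣ ≤ p
    ∣X∣≤p = *-cancelˡ-≤ (suc r) (begin
      suc r * ∣ X ∣                           ≡⟨ ∑-*𝟙∈ (suc r) X ⟨
      ∑[ j < k ] (suc r * 𝟙 (does (j ∈? X)))  ≤⟨ ∑-mono-≤ 1+r*𝟙X≤e ⟩
      ∑[ j < k ] e j                          ≤⟨ ∑e≤ ⟩
      suc r * p                               ∎)
    choose : Dec (∣ Z ∣ ≤ p) → Layer r p e
    choose (yes ∣Z∣≤p) = record
      { layer = Z ; ∣layer∣≤p = ∣Z∣≤p
      ; max⊆layer = λ _ → X⊆Z ∘ ∈-subsetOf⁺ X? ; layer⊆support = λ _ → ∈-subsetOf⁻ Z?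
      ; ∑≤∣layer∣+r*p = begin
          ∑[ j < k ] e j                          ≤⟨ ∑-mono-≤ e≤1+r*𝟙Z ⟩
          ∑[ j < k ] (suc r * 𝟙 (does (j ∈? Z)))  ≡⟨ ∑-*𝟙∈ (suc r) Z ⟩
          ∣ Z ∣ + r * ∣ Z ∣                       ≤⟨ +-monoʳ-≤ ∣ Z ∣ (*-monoʳ-≤ r ∣Z∣≤p) ⟩
          ∣ Z ∣ + r * p                           ∎ }
    choose (no ∣Z∣≰p) with Y , X⊆Y , Y⊆Z , ∣Y∣≡p ← ⊆-⊆-ofSize p X⊆Z ∣X∣≤p (<⇒≤ (≰⇒> ∣Z∣≰p)) = record
      { layer = Y ; ∣layer∣≤p = ≤-reflexive ∣Y∣≡p
      ; max⊆layer = λ _ → X⊆Y ∘ ∈-subsetOf⁺ X? ; layer⊆support = λ _ → ∈-subsetOf⁻ Z? ∘ Y⊆Z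
      ; ∑≤∣layer∣+r*p = ≤-trans ∑e≤ (≤-reflexive (cong (_+ r * p) (sym ∣Y∣≡p))) }

  module _ {k} {r p : ℕ} {e : Fin k → ℕ} (L : Layer r p e) where

    open Layer L

    remainder : Fin k → ℕ
    remainder j = e j ∸ 𝟙 (does (j ∈? layer))

    e≤𝟙layer+remainder : ∀ j → e j ≤ 𝟙 (does (j ∈? layer)) + remainder j
    e≤𝟙layer+remainder j = m≤n+m∸n (e j) (𝟙 (does (j ∈? layer)))

    remainder≤r : (∀ j → e j ≤ suc r) → ∀ j → remainder j ≤ r
    remainder≤r e≤1+r j with j ∈? layer
    ... | yes _ = m≤n+o⇒m∸n≤o (e j) 1 (e≤1+r j)
    ... | no j∉layer = ≮⇒≥ (j∉layer ∘ max⊆layer j)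

    ∑remainder≤r*p : ∑[ j < k ] remainder j ≤ r * p
    ∑remainder≤r*p = +-cancelʳ-≤ ∣ layer ∣ _ _ (begin
      ∑[ j < k ] remainder j + ∣ layer ∣
        ≡⟨ cong (∑[ j < k ] remainder j +_) (∣p∣≡∑𝟙∈ layer) ⟩
      ∑[ j < k ] remainder j + ∑[ j < k ] 𝟙 (does (j ∈? layer))
        ≡⟨ ∑-distrib-+ remainder _ ⟨
      ∑[ j < k ] (remainder j + 𝟙 (does (j ∈? layer)))
        ≡⟨ sum-cong-≗ (λ j → m∸n+n≡m (𝟙layer≤e j)) ⟩
      ∑[ j < k ] e j
        ≤⟨ ∑≤∣layer∣+r*p ⟩
      ∣ layer ∣ + r * p
        ≡⟨ +-comm ∣ layer ∣ (r * p) ⟩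
      r * p + ∣ layer ∣ ∎)
      where
      open ≤-Reasoning
      𝟙layer≤e : ∀ j → 𝟙 (does (j ∈? layer)) ≤ e j
      𝟙layer≤e j with j ∈? layer
      ... | yes j∈layer = layer⊆support j j∈layer
      ... | no _ = z≤n

  Cover : ∀ {k} (r p : ℕ) (e : Fin k → ℕ) → Set
  Cover {k} r p e = Σ[ S ∈ (Fin r → Subset k) ] (∀ ℓ → ∣ S ℓ ∣ ≤ p) × (∀ j → e j ≤ countIn j S)

  extend-cover : ∀ {k r p} {e : Fin k → ℕ} (L : Layer r p e) → Cover r p (remainder L) → Cover (suc r) p e
  extend-cover {e = e} L (S , ∣S∣≤p , remainder≤countIn) =
    layer ◂ S , (λ { zero → ∣layer∣≤p ; (suc ℓ) → ∣S∣≤p ℓ }) , covered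
    where
    open Layer L
    covered : ∀ j → e j ≤ countIn j (layer ◂ S)
    covered j = begin
      e j                                    ≤⟨ e≤𝟙layer+remainder L j ⟩
      𝟙 (does (j ∈? layer)) + remainder L j  ≤⟨ +-monoʳ-≤ _ (remainder≤countIn j) ⟩
      𝟙 (does (j ∈? layer)) + countIn j S    ≡⟨ ∣b∷p∣≡𝟙b+∣p∣ _ (tabulate λ ℓ → does (j ∈? S ℓ)) ⟨
      countIn j (layer ◂ S)                  ∎
      where open ≤-Reasoning

  cover-exists : ∀ {k} r p (e : Fin k → ℕ) → (∀ j → e j ≤ r) → ∑[ j < k ] e j ≤ r * p → Cover r p e
  cover-exists zero p e e≤0 _ = (λ ()) , (λ ()) , e≤0
  cover-exists (suc r) p e e≤1+r ∑e≤ =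
    extend-cover L (cover-exists r p (remainder L) (remainder≤r L e≤1+r) (∑remainder≤r*p L))
    where
    L : Layer r p e
    L = layer-exists r p e e≤1+r ∑e≤

  exact-cover-exists : ∀ {k} r q (e : Fin k → ℕ) → (∀ j → e j ≤ r) → ∑[ j < k ] e j ≤ r * q → q ≤ k →
    Σ[ V ∈ (Fin r → Subset k) ] (∀ ℓ → ∣ V ℓ ∣ ≡ q) × (∀ j → e j ≤ countIn j V)
  exact-cover-exists {k} r q e e≤r ∑e≤ q≤k with S , ∣S∣≤q , e≤countIn ← cover-exists r q e e≤r ∑e≤ =
    V , proj₂ ∘ proj₂ ∘ padded ,
    λ j → ≤-trans (e≤countIn j) (countIn-mono j j (λ ℓ → proj₁ (proj₂ (padded ℓ))))
    where
    padded : ∀ ℓ → Σ[ Y ∈ Subset k ] S ℓ ⊆ Y × ∣ Y ∣ ≡ q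
    padded ℓ = ⊇-ofSize (S ℓ) (∣S∣≤q ℓ) q≤k
    V : Fin r → Subset k
    V = proj₁ ∘ padded

  -- Disjoint sequences

  module _ {k λ′ k₁ k₂ : ℕ} {U : Fin λ′ → Subset k} (disjoint : Disjoint k₁ k₂ U) (j : Fin k) where

    private
      column : Subset λ′
      column = subsetOf (λ ℓ → j ∈? U ℓ)

    Disjoint⇒countIn<k₁ : countIn j U < k₁
    Disjoint⇒countIn<k₁ = ≰⇒> λ k₁≤countIn →
      let B , B⊆column , ∣B∣≡k₁ = ⊆-ofSize k₁ k₁≤countIn
      in proj₁ disjoint B ∣B∣≡k₁ (j , λ ℓ → ∈-subsetOf⁻ (λ ℓ → j ∈? U ℓ) ∘ B⊆column)

    Disjoint⇒λ′∸countIn<k₂ : λ′ ∸ countIn j U < k₂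
    Disjoint⇒λ′∸countIn<k₂ = ≰⇒> λ k₂≤λ′∸countIn →
      let B , B⊆∁column , ∣B∣≡k₂ =
            ⊆-ofSize k₂ (≤-trans k₂≤λ′∸countIn (≤-reflexive (sym (∣∁p∣≡n∸∣p∣ column))))
          ℓ , ℓ∈B , j∈Uℓ = proj₂ disjoint B ∣B∣≡k₂ j
      in x∈∁p⇒x∉p (B⊆∁column ℓ∈B) (∈-subsetOf⁺ (λ ℓ → j ∈? U ℓ) j∈Uℓ)

  module _ {k λ′ r s : ℕ} {U : Fin λ′ → Subset k}
           (s≤λ′+r : s ≤ λ′ + r) (disjoint : Disjoint (s + 1) (λ′ + r ∸ s + 1) U) (j : Fin k) where

    countIn≤s : countIn j U ≤ s
    countIn≤s = m<1+n⇒m≤n (subst (countIn j U <_) (+-comm s 1) (Disjoint⇒countIn<k₁ disjoint j))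

    s∸countIn≤r : s ∸ countIn j U ≤ r
    s∸countIn≤r = m≤n+o⇒m∸n≤o s d (+-cancelˡ-≤ (λ′ ∸ d) _ _ (begin
      λ′ ∸ d + s        ≤⟨ m≤o∸n⇒m+n≤o (λ′ ∸ d) s≤λ′+r missing≤ ⟩
      λ′ + r            ≡⟨ cong (_+ r) (m∸n+n≡m (∣p∣≤n (tabulate λ ℓ → does (j ∈? U ℓ)))) ⟨
      λ′ ∸ d + d + r    ≡⟨ +-assoc (λ′ ∸ d) d r ⟩
      λ′ ∸ d + (d + r)  ∎))
      where
      open ≤-Reasoning
      d : ℕ
      d = countIn j U
      missing≤ : λ′ ∸ d ≤ λ′ + r ∸ s
      missing≤ = m<1+n⇒m≤n (subst (λ′ ∸ d <_) (+-comm (λ′ + r ∸ s) 1) (Disjoint⇒λ′∸countIn<k₂ disjoint j))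

  ∑[s∸countIn]≡r*q : ∀ {k λ′ r s q} (U : Fin λ′ → Subset k) → (∀ ℓ → ∣ U ℓ ∣ ≡ suc q) →
    (∀ j → countIn j U ≤ s) → s * k ≡ q * (λ′ + r) + λ′ → ∑[ j < k ] (s ∸ countIn j U) ≡ r * q
  ∑[s∸countIn]≡r*q {k} {λ′} {r} {s} {q} U ∣U∣≡1+q countIn≤s s*k≡ = +-cancelʳ-≡ (λ′ * suc q) _ _ (begin
    ∑[ j < k ] (s ∸ d j) + λ′ * suc q      ≡⟨ cong (∑[ j < k ] (s ∸ d j) +_) ∑d≡λ′*[1+q] ⟨
    ∑[ j < k ] (s ∸ d j) + ∑[ j < k ] d j  ≡⟨ ∑-distrib-+ (λ j → s ∸ d j) d ⟨
    ∑[ j < k ] (s ∸ d j + d j)             ≡⟨ sum-cong-≗ (λ j → m∸n+n≡m (countIn≤s j)) ⟩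
    ∑[ j < k ] s                           ≡⟨ ∑-const k s ⟩
    k * s                                  ≡⟨ *-comm k s ⟩
    s * k                                  ≡⟨ s*k≡ ⟩
    q * (λ′ + r) + λ′                      ≡⟨ regroup q λ′ r ⟩
    r * q + λ′ * suc q                     ∎)
    where
    open ≡-Reasoning
    d : Fin k → ℕ
    d j = countIn j U
    ∑d≡λ′*[1+q] : ∑[ j < k ] d j ≡ λ′ * suc q
    ∑d≡λ′*[1+q] = trans (∑countIn≡∑∣∣ U) (trans (sum-cong-≗ ∣U∣≡1+q) (∑-const λ′ (suc q)))
    regroup : ∀ q λ′ r → q * (λ′ + r) + λ′ ≡ r * q + λ′ * suc q
    regroup = solve-∀

  complete-cover : ∀ {k λ′ r s q} (U : Fin λ′ → Subset k) → (∀ ℓ → ∣ U ℓ ∣ ≡ suc q) →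
    s ≤ λ′ + r → s * k ≡ q * (λ′ + r) + λ′ → q ≤ k → Disjoint (s + 1) (λ′ + r ∸ s + 1) U →
    Σ[ V ∈ (Fin r → Subset k) ] (∀ ℓ → ∣ V ℓ ∣ ≡ q) × (∀ j → s ≤ countIn j (U ++ V))
  complete-cover {k} {λ′} {r} {s} {q} U ∣U∣≡1+q s≤λ′+r s*k≡ q≤k disjoint
    with V , ∣V∣≡q , deficit≤countIn ←
         exact-cover-exists r q (λ j → s ∸ countIn j U) (s∸countIn≤r s≤λ′+r disjoint)
           (≤-reflexive (∑[s∸countIn]≡r*q U ∣U∣≡1+q (countIn≤s s≤λ′+r disjoint) s*k≡)) q≤k =
    V , ∣V∣≡q , λ j → begin
      s                                ≤⟨ m≤n+m∸n s (countIn j U) ⟩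
      countIn j U + (s ∸ countIn j U)  ≤⟨ +-monoʳ-≤ (countIn j U) (deficit≤countIn j) ⟩
      countIn j U + countIn j V        ≡⟨ countIn-++ j U V ⟨
      countIn j (U ++ V)               ∎
    where open ≤-Reasoning

  -- Arithmetic of t = ⌈ s k / c ⌉

  ⌈[q*c+r]/c⌉≡1+q : ∀ q c r .{{_ : NonZero c}} → 1 ≤ r → r ≤ c → ⌈ q * c + r / c ⌉ ≡ suc q
  ⌈[q*c+r]/c⌉≡1+q q (suc c′) (suc l) _ (s≤s l≤c′) = begin
    (q * c + suc l + c′) / c  ≡⟨ /-congˡ (regroup q c′ l) ⟩
    (l + suc q * c) / c       ≡⟨ +-distrib-/-∣ʳ l (n∣m*n (suc q)) ⟩
    l / c + suc q * c / c     ≡⟨ cong₂ _+_ (m<n⇒m/n≡0 (s≤s l≤c′)) (m*n/n≡m (suc q) c) ⟩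
    suc q                     ∎
    where
    open ≡-Reasoning
    c : ℕ
    c = suc c′
    regroup : ∀ q c′ l → q * suc c′ + suc l + c′ ≡ l + suc q * suc c′
    regroup = solve-∀

  r%c≡a%c⇒∃[q]a≡q*c+r : ∀ a c r .{{_ : NonZero c}} → 1 ≤ a → r ≤ c → r % c ≡ a % c →
    Σ[ q ∈ ℕ ] a ≡ q * c + r
  r%c≡a%c⇒∃[q]a≡q*c+r a c r 1≤a r≤c r%c≡a%c with r <? c
  ... | yes r<c = a / c , (begin
    a                  ≡⟨ m≡m%n+[m/n]*n a c ⟩
    a % c + a / c * c  ≡⟨ cong (_+ a / c * c) (trans (sym r%c≡a%c) (m<n⇒m%n≡m r<c)) ⟩
    r + a / c * c      ≡⟨ +-comm r (a / c * c) ⟩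
    a / c * c + r      ∎)
    where open ≡-Reasoning
  ... | no r≮c = from-multiple (a / c) (trans (m≡m%n+[m/n]*n a c) (cong (_+ a / c * c) a%c≡0))
    where
    r≡c : r ≡ c
    r≡c = ≤-antisym r≤c (≮⇒≥ r≮c)
    a%c≡0 : a % c ≡ 0
    a%c≡0 = trans (sym r%c≡a%c) (trans (cong (_% c) r≡c) (n%n≡0 c))
    from-multiple : ∀ q → a ≡ q * c → Σ[ q ∈ ℕ ] a ≡ q * c + r
    from-multiple zero a≡0 = contradiction (subst (1 ≤_) a≡0 1≤a) λ ()
    from-multiple (suc q) a≡[1+q]*c =
      q , trans a≡[1+q]*c (trans (+-comm c (q * c)) (cong (q * c +_) (sym r≡c)))

  s*k≡q*c+r⇒q≤k : ∀ {q c r s k} .{{_ : NonZero c}} → s ≤ c → s * k ≡ q * c + r → q ≤ k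
  s*k≡q*c+r⇒q≤k {q} {c} {r} {s} {k} s≤c s*k≡ = *-cancelʳ-≤ q k c (begin
    q * c      ≤⟨ m≤m+n (q * c) r ⟩
    q * c + r  ≡⟨ s*k≡ ⟨
    s * k      ≤⟨ *-monoˡ-≤ k s≤c ⟩
    c * k      ≡⟨ *-comm c k ⟩
    k * c      ∎)
    where open ≤-Reasoning

  -- Own and covered subsets

  module _ {n} (F : List (Subset n)) (A : Subset n) where

    Covered : Subset n → Set
    Covered T = Σ[ B ∈ Subset n ] B ∈ₗ F × B ≢ A × T ⊆ B

    covered? : ∀ T → Dec (Covered T)
    covered? T = map′ find (λ (B , B∈F , B≢A×T⊆B) → lose B∈F B≢A×T⊆B)
                   (any? (λ B → ¬? (≡-dec Bool._≟_ B A) ×-dec T ⊆? B) F)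

    ¬Covered⇒Own : ∀ {T} → T ⊆ A → ¬ Covered T → Own F A T
    ¬Covered⇒Own T⊆A ¬covered = T⊆A , λ B B∈F B≢A T⊆B → ¬covered (B , B∈F , B≢A , T⊆B)

    ¬Own⇒Covered : ∀ {T} → T ⊆ A → ¬ Own F A T → Covered T
    ¬Own⇒Covered {T} T⊆A ¬own = decidable-stable (covered? T) (¬own ∘ ¬Covered⇒Own T⊆A)

    Frameproof⇒¬covering : ∀ {c s} → Frameproof c s F → A ∈ₗ F →
      (T : Fin c → Subset n) → (∀ ℓ → Covered (T ℓ)) → ¬ (∀ {i} → i ∈ A → s ≤ countIn i T)
    Frameproof⇒¬covering {c} {s} fp A∈F T covered s≤countIn =
      refute (fp A A∈F B (proj₁ ∘ proj₂ ∘ covered) (≢-sym ∘ proj₁ ∘ proj₂ ∘ proj₂ ∘ covered))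
      where
      B : Fin c → Subset n
      B = proj₁ ∘ covered
      refute : ¬ (Σ[ i ∈ Fin n ] i ∈ A × countIn i B < s)
      refute (i , i∈A , countIn<s) =
        <⇒≱ countIn<s (≤-trans (s≤countIn i∈A) (countIn-mono i i (λ ℓ → proj₂ (proj₂ (proj₂ (covered ℓ))))))

    Frameproof⇒¬embedded-covering : ∀ {c s} → Frameproof c s F → A ∈ₗ F →
      (W : Fin c → Subset ∣ A ∣) → (∀ ℓ → Covered (embed A (W ℓ))) → ¬ (∀ j → s ≤ countIn j W)
    Frameproof⇒¬embedded-covering fp A∈F W covered s≤countIn =
      Frameproof⇒¬covering fp A∈F (embed A ∘ W) covered λ {i} i∈A →
        let j , j∈⇒i∈ = ∈-embed i∈A
        in ≤-trans (s≤countIn j) (countIn-mono {X = W} {Y = embed A ∘ W} j i (λ _ → j∈⇒i∈))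

  covered-sequence-¬Disjoint : ∀ {n} {F : List (Subset n)} {A : Subset n} {c s λ′ r q} .{{_ : NonZero c}} →
    Frameproof c s F → A ∈ₗ F → c ≡ λ′ + r → s ≤ c → s * ∣ A ∣ ≡ q * c + λ′ →
    (∀ T → T ⊆ A → ∣ T ∣ ≡ q → ¬ Own F A T) →
    (U : Fin λ′ → Subset ∣ A ∣) → (∀ ℓ → ∣ U ℓ ∣ ≡ suc q) → (∀ ℓ → Covered F A (embed A (U ℓ))) →
    ¬ Disjoint (s + 1) (c ∸ s + 1) U
  covered-sequence-¬Disjoint {F = F} {A} {r = r} {q} fp A∈F refl s≤c s*∣A∣≡ noOwn U ∣U∣≡1+q U-covered
    disjoint with V , ∣V∣≡q , s≤countIn ←
                  complete-cover {r = r} U ∣U∣≡1+q s≤c s*∣A∣≡ (s*k≡q*c+r⇒q≤k s≤c s*∣A∣≡) disjoint =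
    Frameproof⇒¬embedded-covering F A fp A∈F (U ++ V)
      (Allᶠ.++⁺ (Covered F A ∘ embed A) U-covered V-covered) s≤countIn
    where
    V-covered : ∀ ℓ → Covered F A (embed A (V ℓ))
    V-covered ℓ = ¬Own⇒Covered F A (embed-⊆ A (V ℓ))
                    (noOwn _ (embed-⊆ A (V ℓ)) (trans (∣embed∣ A (V ℓ)) (∣V∣≡q ℓ)))

  length-filter-¬+length-filter : ∀ {X : Set} {P : X → Set} (P? : ∀ x → Dec (P x)) xs →
    length (filter (¬? ∘ P?) xs) + length (filter P? xs) ≡ length xs
  length-filter-¬+length-filter P? [] = refl
  length-filter-¬+length-filter P? (x ∷ xs) with P? x
  ... | yes _ = trans (+-suc _ _) (cong suc (length-filter-¬+length-filter P? xs))
  ... | no _ = cong suc (length-filter-¬+length-filter P? xs)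

  module _ {n} (F : List (Subset n)) (A : Subset n) (t : ℕ) where

    private
      embedding-covered? : ∀ U → Dec (Covered F A (embed A U))
      embedding-covered? U = covered? F A (embed A U)

    coveredSubsets : List (Subset ∣ A ∣)
    coveredSubsets = filter embedding-covered? (combinations ∣ A ∣ t)

    uncoveredSubsets : List (Subset ∣ A ∣)
    uncoveredSubsets = filter (¬? ∘ embedding-covered?) (combinations ∣ A ∣ t)

    ownSubsets : List (Subset n)
    ownSubsets = List.map (embed A) uncoveredSubsets

    ownSubsets-unique : Unique ownSubsets
    ownSubsets-unique = Unique.map⁺ (embed-injective A) (Unique.filter⁺ _ (combinations-unique ∣ A ∣ t))

    ownSubsets-own : All (λ T → ∣ T ∣ ≡ t × Own F A T) ownSubsets
    ownSubsets-own = All.map⁺ (All.tabulate λ {U} U∈ →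
      let U∈combinations , ¬covered = ∈-filter⁻ (¬? ∘ embedding-covered?) U∈
      in trans (∣embed∣ A U) (All.lookup (combinations-size ∣ A ∣ t) U∈combinations) ,
         ¬Covered⇒Own F A (embed-⊆ A U) ¬covered)

    C∸m≤length-ownSubsets : ∀ {m} → length coveredSubsets ≤ m → ∣ A ∣ C t ∸ m ≤ length ownSubsets
    C∸m≤length-ownSubsets {m} covered≤m = begin
      ∣ A ∣ C t ∸ m
        ≤⟨ ∸-monoʳ-≤ (∣ A ∣ C t) covered≤m ⟩
      ∣ A ∣ C t ∸ length coveredSubsets
        ≡⟨ cong (_∸ length coveredSubsets) (length-combinations ∣ A ∣ t) ⟨
      length (combinations ∣ A ∣ t) ∸ length coveredSubsets
        ≡⟨ cong (_∸ length coveredSubsets)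
                (length-filter-¬+length-filter embedding-covered? (combinations ∣ A ∣ t)) ⟨
      length uncoveredSubsets + length coveredSubsets ∸ length coveredSubsets
        ≡⟨ m+n∸n≡m (length uncoveredSubsets) (length coveredSubsets) ⟩
      length uncoveredSubsets
        ≡⟨ length-map (embed A) uncoveredSubsets ⟨
      length ownSubsets ∎
      where open ≤-Reasoning

    coveredSubsets-admissible : ∀ {c s λ′ r q} .{{_ : NonZero c}} →
      Frameproof c s F → A ∈ₗ F → c ≡ λ′ + r → s ≤ c → s * ∣ A ∣ ≡ q * c + λ′ → t ≡ suc q →
      (∀ T → T ⊆ A → ∣ T ∣ ≡ q → ¬ Own F A T) →
      Admissible ∣ A ∣ t λ′ (s + 1) (c ∸ s + 1) coveredSubsets
    coveredSubsets-admissible fp A∈F c≡λ′+r s≤c s*∣A∣≡ t≡1+q noOwn =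
      Unique.filter⁺ embedding-covered? (combinations-unique ∣ A ∣ t) ,
      All.filter⁺ embedding-covered? (combinations-size ∣ A ∣ t) ,
      λ U U∈ → covered-sequence-¬Disjoint fp A∈F c≡λ′+r s≤c s*∣A∣≡ noOwn U
        (λ ℓ → trans (All.lookup (combinations-size ∣ A ∣ t) (proj₁ (∈coveredSubsets⁻ (U∈ ℓ)))) t≡1+q)
        (proj₂ ∘ ∈coveredSubsets⁻ ∘ U∈)
      where
      ∈coveredSubsets⁻ : ∀ {U} → U ∈ₗ coveredSubsets → U ∈ₗ combinations ∣ A ∣ t × Covered F A (embed A U)
      ∈coveredSubsets⁻ = ∈-filter⁻ embedding-covered?

open import Data.Nat using (ℕ; _+_; _*_; _∸_; _≤_; NonZero)
open import Data.Nat.DivMod using (_%_)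
open import Data.Nat.Combinatorics using (_C_)
open import Data.Fin.Subset using (Subset; _⊆_; ∣_∣)
open import Data.List using (List; length)
open import Data.List.Membership.Propositional using (_∈_)
open import Data.List.Relation.Unary.All using (All)
open import Data.List.Relation.Unary.Unique.Propositional using (Unique)
open import Data.Product using (Σ; _×_)
open import Relation.Nullary using (¬_)
open import Relation.Binary.PropositionalEquality using (_≡_)
open import Data.Nat using (suc)
open import Data.Nat.Properties using (≤-trans; n≤1+n; *-mono-≤; m∸n≤m; m+[n∸m]≡n)
open import Data.Product using (_,_; proj₂)
open import Relation.Binary.PropositionalEquality using (refl; sym; trans; cong)
import Data.List.Relation.Unary.All as All

lemma2p3 : (n k c s λ′ m : ℕ) → .{{_ : NonZero c}} →
    2 ≤ k → k ≤ n → 2 ≤ c → 1 ≤ s → s ≤ c ∸ 1 →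
    1 ≤ λ′ → λ′ ≤ c → λ′ % c ≡ (s * k) % c →
    IsM k ⌈ s * k / c ⌉ λ′ (s + 1) (c ∸ s + 1) m →
    (F : List (Subset n)) → Unique F → Uniform k F → Frameproof c s F →
    (A : Subset n) → A ∈ F →
    (∀ T → T ⊆ A → ∣ T ∣ ≡ ⌈ s * k / c ⌉ ∸ 1 → ¬ Own F A T) →
    Σ (List (Subset n)) λ Ts →
      Unique Ts
      × All (λ T → ∣ T ∣ ≡ ⌈ s * k / c ⌉ × Own F A T) Ts
      × (k C ⌈ s * k / c ⌉) ∸ m ≤ length Ts
lemma2p3 n k c s λ′ m 2≤k _ _ 1≤s s≤c∸1 1≤λ′ λ′≤c λ′%c≡s*k%c isM F _ uniform fp A A∈F noOwn
  with refl ← All.lookup uniform A∈F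
  with q , s*k≡q*c+λ′ ←
       r%c≡a%c⇒∃[q]a≡q*c+r (s * k) c λ′ (*-mono-≤ 1≤s (≤-trans (n≤1+n 1) 2≤k)) λ′≤c λ′%c≡s*k%c =
  ownSubsets F A t , ownSubsets-unique F A t , ownSubsets-own F A t ,
  C∸m≤length-ownSubsets F A t (proj₂ isM _ coveredSubsets-admissible′)
  where
  t : ℕ
  t = ⌈ s * k / c ⌉
  t≡1+q : t ≡ suc q
  t≡1+q = trans (cong (λ a → ⌈ a / c ⌉) s*k≡q*c+λ′) (⌈[q*c+r]/c⌉≡1+q q c λ′ 1≤λ′ λ′≤c)
  s≤c : s ≤ c
  s≤c = ≤-trans s≤c∸1 (m∸n≤m c 1)
  c≡λ′+[c∸λ′] : c ≡ λ′ + (c ∸ λ′)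
  c≡λ′+[c∸λ′] = sym (m+[n∸m]≡n λ′≤c)
  noOwn′ : ∀ T → T ⊆ A → ∣ T ∣ ≡ q → ¬ Own F A T
  noOwn′ T T⊆A ∣T∣≡q = noOwn T T⊆A (trans ∣T∣≡q (cong (_∸ 1) (sym t≡1+q)))
  coveredSubsets-admissible′ : Admissible k t λ′ (s + 1) (c ∸ s + 1) (coveredSubsets F A t)
  coveredSubsets-admissible′ =
    coveredSubsets-admissible F A t fp A∈F c≡λ′+[c∸λ′] s≤c s*k≡q*c+λ′ t≡1+q noOwn′
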